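{- For every natural number $n\ge 0$, over $\mathsf{DB}_0$ the schema $\mathsf{Coll}_s^-(\Sigma_n)$ is deductively equivalent to $\mathsf{Coll}_s(\Sigma_n)$.
   Context: Language $\mathcal{L}_\in=\{\in,=\}$, Lévy hierarchy. $\mathsf{DB}_0$ consists of extensionality, nullset, pairing, union, cartesian product and $\Delta_0$-separation. For a formula $\varphi(x,y,v)$, $\mathsf{Coll}_s(\varphi)$ is $\forall v\forall p\exists q\forall x\in p(\exists y\,\varphi(x,y,v)\leftrightarrow\exists y\in q\,\varphi(x,y,v))$. For a formula $\varphi(x,y)$ with no other free variables, $\mathsf{Coll}_s^-(\varphi)$ is $\forall p\exists q\forall x\in p(\exists y\,\varphi(x,y)\leftrightarrow\exists y\in q\,\varphi(x,y))$. $\mathsf{Coll}_s(\Sigma_n)$ (resp. $\mathsf{Coll}_s^-(\Sigma_n)$) is the schema of all such axioms for $\Sigma_n$ formulas. -}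

module Defs where

open import Data.Nat using (ℕ; zero; suc)
open import Data.Fin using (Fin; zero; suc)
open import Data.List using (List; []; _∷_; map)
open import Data.List.Membership.Propositional using (_∈_)
open import Data.List.Relation.Unary.All using (All)
open import Data.Product using (Σ; _×_; ∃)
open import Data.Sum using (_⊎_)

-- A formula of type  Fm k  has its free variables among  Fin k
-- (de Bruijn indices: 'zero' is the innermost bound / last variable).
-- The language has no function symbols, so the terms are variables.

infixr 4 _⇒_ _⇔_
infixr 5 _∨'_
infixr 6 _∧'_
infix 7 _∈'_ _≐_

data Fm : ℕ → Set where
  _∈'_ : ∀ {k} → Fin k → Fin k → Fm k
  _≐_  : ∀ {k} → Fin k → Fin k → Fm k
  ⊥'   : ∀ {k} → Fm k
  _∧'_ : ∀ {k} → Fm k → Fm k → Fm k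
  _∨'_ : ∀ {k} → Fm k → Fm k → Fm k
  _⇒_  : ∀ {k} → Fm k → Fm k → Fm k
  ∀'   : ∀ {k} → Fm (suc k) → Fm k
  ∃'   : ∀ {k} → Fm (suc k) → Fm k

¬' : ∀ {k} → Fm k → Fm k
¬' φ = φ ⇒ ⊥'

_⇔_ : ∀ {k} → Fm k → Fm k → Fm k
φ ⇔ ψ = (φ ⇒ ψ) ∧' (ψ ⇒ φ)

∀∈ : ∀ {k} → Fin k → Fm (suc k) → Fm k
∀∈ y φ = ∀' ((zero ∈' suc y) ⇒ φ)

∃∈ : ∀ {k} → Fin k → Fm (suc k) → Fm k
∃∈ y φ = ∃' ((zero ∈' suc y) ∧' φ)

-- renaming of variables (= substitution, since terms are variables)
lift : ∀ {k m} → (Fin k → Fin m) → Fin (suc k) → Fin (suc m)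
lift ρ zero    = zero
lift ρ (suc i) = suc (ρ i)

rename : ∀ {k m} → (Fin k → Fin m) → Fm k → Fm m
rename ρ (x ∈' y) = ρ x ∈' ρ y
rename ρ (x ≐ y)  = ρ x ≐ ρ y
rename ρ ⊥'       = ⊥'
rename ρ (φ ∧' ψ) = rename ρ φ ∧' rename ρ ψ
rename ρ (φ ∨' ψ) = rename ρ φ ∨' rename ρ ψ
rename ρ (φ ⇒ ψ)  = rename ρ φ ⇒ rename ρ ψ
rename ρ (∀' φ)   = ∀' (rename (lift ρ) φ)
rename ρ (∃' φ)   = ∃' (rename (lift ρ) φ)

wk : ∀ {k} → Fm k → Fm (suc k)
wk = rename suc

sub0 : ∀ {k} → Fin k → Fin (suc k) → Fin k
sub0 t zero    = t
sub0 t (suc i) = i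

_[_] : ∀ {k} → Fm (suc k) → Fin k → Fm k
φ [ t ] = rename (sub0 t) φ

wk0 : ∀ {k} → Fm 0 → Fm k
wk0 = rename (λ ())

∀* : ∀ {k} → Fm k → Fm 0
∀* {zero}  φ = φ
∀* {suc k} φ = ∀* (∀' φ)

infix 3 _⊢_

data _⊢_ : ∀ {k} → List (Fm k) → Fm k → Set where
  hyp  : ∀ {k} {Γ : List (Fm k)} {φ} → φ ∈ Γ → Γ ⊢ φ
  ⊥E   : ∀ {k} {Γ : List (Fm k)} {φ} → Γ ⊢ ⊥' → Γ ⊢ φ
  raa  : ∀ {k} {Γ : List (Fm k)} {φ} → (¬' φ ∷ Γ) ⊢ ⊥' → Γ ⊢ φ
  ⇒I   : ∀ {k} {Γ : List (Fm k)} {φ ψ} → (φ ∷ Γ) ⊢ ψ → Γ ⊢ φ ⇒ ψ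
  ⇒E   : ∀ {k} {Γ : List (Fm k)} {φ ψ} → Γ ⊢ φ ⇒ ψ → Γ ⊢ φ → Γ ⊢ ψ
  ∧I   : ∀ {k} {Γ : List (Fm k)} {φ ψ} → Γ ⊢ φ → Γ ⊢ ψ → Γ ⊢ φ ∧' ψ
  ∧E₁  : ∀ {k} {Γ : List (Fm k)} {φ ψ} → Γ ⊢ φ ∧' ψ → Γ ⊢ φ
  ∧E₂  : ∀ {k} {Γ : List (Fm k)} {φ ψ} → Γ ⊢ φ ∧' ψ → Γ ⊢ ψ
  ∨I₁  : ∀ {k} {Γ : List (Fm k)} {φ ψ} → Γ ⊢ φ → Γ ⊢ φ ∨' ψ
  ∨I₂  : ∀ {k} {Γ : List (Fm k)} {φ ψ} → Γ ⊢ ψ → Γ ⊢ φ ∨' ψ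
  ∨E   : ∀ {k} {Γ : List (Fm k)} {φ ψ χ} → Γ ⊢ φ ∨' ψ →
         (φ ∷ Γ) ⊢ χ → (ψ ∷ Γ) ⊢ χ → Γ ⊢ χ
  ∀I   : ∀ {k} {Γ : List (Fm k)} {φ : Fm (suc k)} → map wk Γ ⊢ φ → Γ ⊢ ∀' φ
  ∀E   : ∀ {k} {Γ : List (Fm k)} {φ : Fm (suc k)} → Γ ⊢ ∀' φ → (t : Fin k) → Γ ⊢ φ [ t ]
  ∃I   : ∀ {k} {Γ : List (Fm k)} {φ : Fm (suc k)} (t : Fin k) → Γ ⊢ φ [ t ] → Γ ⊢ ∃' φ
  ∃E   : ∀ {k} {Γ : List (Fm k)} {φ : Fm (suc k)} {χ} → Γ ⊢ ∃' φ →
         (φ ∷ map wk Γ) ⊢ wk χ → Γ ⊢ χ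
  ≐refl  : ∀ {k} {Γ : List (Fm k)} (t : Fin k) → Γ ⊢ t ≐ t
  ≐subst : ∀ {k} {Γ : List (Fm k)} (φ : Fm (suc k)) {s t : Fin k} →
           Γ ⊢ s ≐ t → Γ ⊢ φ [ s ] → Γ ⊢ φ [ t ]

-- T ⊩ σ : σ is derivable from finitely
-- many axioms of T (the derivation may use any number k of extra free
-- variables, i.e. the usual nonempty-domain first-order logic).
Theory : Set₁
Theory = Fm 0 → Set

_∪_ : Theory → Theory → Theory
(T ∪ U) σ = T σ ⊎ U σ

infix 2 _⊩_
_⊩_ : Theory → Fm 0 → Set
T ⊩ σ = Σ ℕ λ k → Σ (List (Fm 0)) λ Γ → All T Γ × (map (wk0 {k}) Γ ⊢ wk0 σ)

EquivOver : Theory → Theory → Theory → Set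
EquivOver B T U = (∀ σ → U σ → (B ∪ T) ⊩ σ) × (∀ σ → T σ → (B ∪ U) ⊩ σ)

data Δ₀ : ∀ {k} → Fm k → Set where
  d∈ : ∀ {k} (x y : Fin k) → Δ₀ (x ∈' y)
  d≐ : ∀ {k} (x y : Fin k) → Δ₀ (x ≐ y)
  d⊥ : ∀ {k} → Δ₀ (⊥' {k})
  d∧ : ∀ {k} {φ ψ : Fm k} → Δ₀ φ → Δ₀ ψ → Δ₀ (φ ∧' ψ)
  d∨ : ∀ {k} {φ ψ : Fm k} → Δ₀ φ → Δ₀ ψ → Δ₀ (φ ∨' ψ)
  d⇒ : ∀ {k} {φ ψ : Fm k} → Δ₀ φ → Δ₀ ψ → Δ₀ (φ ⇒ ψ)
  d∀∈ : ∀ {k} (y : Fin k) {φ : Fm (suc k)} → Δ₀ φ → Δ₀ (∀∈ y φ)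
  d∃∈ : ∀ {k} (y : Fin k) {φ : Fm (suc k)} → Δ₀ φ → Δ₀ (∃∈ y φ)

-- Σ₀ = Π₀ = Δ₀;  Σₙ₊₁ = ∃x̄ Πₙ;  Πₙ₊₁ = ∀x̄ Σₙ  (blocks possibly empty)
data IsΣ : ∀ {k} → ℕ → Fm k → Set
data IsΠ : ∀ {k} → ℕ → Fm k → Set

data IsΣ where
  σ0 : ∀ {k} {φ : Fm k} → Δ₀ φ → IsΣ 0 φ
  σπ : ∀ {k n} {φ : Fm k} → IsΠ n φ → IsΣ (suc n) φ
  σ∃ : ∀ {k n} {φ : Fm (suc k)} → IsΣ (suc n) φ → IsΣ (suc n) (∃' φ)

data IsΠ where
  π0 : ∀ {k} {φ : Fm k} → Δ₀ φ → IsΠ 0 φ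
  πσ : ∀ {k n} {φ : Fm k} → IsΣ n φ → IsΠ (suc n) φ
  π∀ : ∀ {k n} {φ : Fm (suc k)} → IsΠ (suc n) φ → IsΠ (suc n) (∀' φ)

-- Auxiliary Δ₀ formulas:  w = {x},  w = {x,y},  z = ⟨x,y⟩ (Kuratowski)

isSing : ∀ {k} → Fin k → Fin k → Fm k
isSing w x = (x ∈' w) ∧' ∀∈ w (zero ≐ suc x)

isUPair : ∀ {k} → Fin k → Fin k → Fin k → Fm k
isUPair w x y = (x ∈' w) ∧' (y ∈' w) ∧' ∀∈ w ((zero ≐ suc x) ∨' (zero ≐ suc y))

isPair : ∀ {k} → Fin k → Fin k → Fin k → Fm k
isPair z x y =
  ∀∈ z (isSing zero (suc x) ∨' isUPair zero (suc x) (suc y)) ∧'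
  ∃∈ z (isSing zero (suc x)) ∧'
  ∃∈ z (isUPair zero (suc x) (suc y))

v0 : ∀ {k} → Fin (suc k)
v0 = zero
v1 : ∀ {k} → Fin (suc (suc k))
v1 = suc zero
v2 : ∀ {k} → Fin (suc (suc (suc k)))
v2 = suc (suc zero)
v3 : ∀ {k} → Fin (suc (suc (suc (suc k))))
v3 = suc (suc (suc zero))
v4 : ∀ {k} → Fin (suc (suc (suc (suc (suc k)))))
v4 = suc (suc (suc (suc zero)))

-- ∀a ∀b (∀z (z∈a ↔ z∈b) → a = b)
Extensionality : Fm 0
Extensionality = ∀' (∀' (∀' ((v0 ∈' v2) ⇔ (v0 ∈' v1)) ⇒ (v1 ≐ v0)))

-- ∃e ∀z ¬ z∈e
Nullset : Fm 0
Nullset = ∃' (∀' (¬' (v0 ∈' v1)))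

-- ∀a ∀b ∃c ∀z (z∈c ↔ z=a ∨ z=b)
Pairing : Fm 0
Pairing = ∀' (∀' (∃' (∀' ((v0 ∈' v1) ⇔ ((v0 ≐ v3) ∨' (v0 ≐ v2))))))

-- ∀a ∃u ∀z (z∈u ↔ ∃w∈a z∈w)
Union : Fm 0
Union = ∀' (∃' (∀' ((v0 ∈' v1) ⇔ ∃∈ v2 (v1 ∈' v0))))

-- ∀a ∀b ∃c ∀z (z∈c ↔ ∃x∈a ∃y∈b z = ⟨x,y⟩)
Product : Fm 0
Product = ∀' (∀' (∃' (∀' ((v0 ∈' v1) ⇔ ∃∈ v3 (∃∈ v3 (isPair v2 v1 v0))))))

-- Δ₀-separation for φ(z, a, p̄) (z = variable 0, a = variable 1,
-- parameters p̄ = the remaining k variables):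
-- ∀p̄ ∀a ∃s ∀z (z∈s ↔ z∈a ∧ φ(z,a,p̄))
sepRen : ∀ {k} → Fin (suc (suc k)) → Fin (suc (suc (suc k)))
sepRen zero          = zero
sepRen (suc zero)    = suc (suc zero)
sepRen (suc (suc i)) = suc (suc (suc i))

Separation : ∀ {k} → Fm (suc (suc k)) → Fm 0
Separation {k} φ = ∀* {suc k} (∃' (∀' ((v0 ∈' v1) ⇔ ((v0 ∈' v2) ∧' rename sepRen φ))))

data DB₀ : Theory where
  ext   : DB₀ Extensionality
  null  : DB₀ Nullset
  pair  : DB₀ Pairing
  union : DB₀ Union
  prod  : DB₀ Product
  sep   : ∀ {k} (φ : Fm (suc (suc k))) → Δ₀ φ → DB₀ (Separation φ)

-- φ(x,y,v) : Fm 3 with  y = variable 0,  x = variable 1,  v = variable 2.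
-- Coll_s(φ):  ∀v ∀p ∃q ∀x∈p (∃y φ(x,y,v) ↔ ∃y∈q φ(x,y,v))
collRen : Fin 3 → Fin 5
collRen zero             = v0
collRen (suc zero)       = v1
collRen (suc (suc zero)) = v4

Collₛ : Fm 3 → Fm 0
Collₛ φ = ∀' (∀' (∃' (∀∈ v1 ((∃' φ') ⇔ ∃∈ v1 φ'))))
  where φ' = rename collRen φ

-- φ(x,y) : Fm 2 with  y = variable 0,  x = variable 1, no other free variables.
-- Coll_s⁻(φ):  ∀p ∃q ∀x∈p (∃y φ(x,y) ↔ ∃y∈q φ(x,y))
collRen⁻ : Fin 2 → Fin 4
collRen⁻ zero       = v0
collRen⁻ (suc zero) = v1

Collₛ⁻ : Fm 2 → Fm 0
Collₛ⁻ φ = ∀' (∃' (∀∈ v1 ((∃' φ') ⇔ ∃∈ v1 φ')))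
  where φ' = rename collRen⁻ φ

data CollₛΣ (n : ℕ) : Theory where
  coll : (φ : Fm 3) → IsΣ n φ → CollₛΣ n (Collₛ φ)

data Collₛ⁻Σ (n : ℕ) : Theory where
  coll⁻ : (φ : Fm 2) → IsΣ n φ → Collₛ⁻Σ n (Collₛ⁻ φ)

{-# OPTIONS --safe #-}
-- Coll_s⁻(ψ) is the instance of Coll_s(ψ) with a dummy parameter.  Conversely, to collect
-- witnesses of a Σₙ formula φ(x, y, v) over p for the parameter v, apply Coll_s⁻ to
--   ψ(z, y) :≡ ∃a∈z ∃b∈a ∃c∈a (z = ⟨b, c⟩ ∧ φ(b, y, c))
-- on p × {v}: the parameter travels inside the Kuratowski pair ⟨x, v⟩, and injectivity of
-- pairing recovers φ(x, y, v) from ψ(⟨x, v⟩, y).  ψ is again Σₙ, since ∃a∈z χ is ∃a (a ∈ z ∧ χ)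
-- and a Δ₀ conjunct can be pushed through the quantifier prefix of a Σₙ formula.
module Submission where

open import Defs
open import Data.Nat using (ℕ; suc)
open import Data.Fin using (Fin; zero; suc; inject₁)
open import Data.List using (List; []; _∷_; map)
open import Data.List.Properties using (map-∘; map-cong)
open import Data.List.Membership.Propositional using (_∈_)
open import Data.List.Membership.Propositional.Properties using (∈-map⁺)
open import Data.List.Relation.Binary.Subset.Propositional using (_⊆_)
open import Data.List.Relation.Binary.Subset.Propositional.Properties
  using (∷⁺ʳ) renaming (map⁺ to map⁺-⊆)
open import Data.List.Relation.Unary.All using ([]; _∷_)
open import Data.List.Relation.Unary.Any using (here; there)
open import Data.Vec using (Vec; []; _∷_; lookup) renaming (map to vmap)
open import Data.Vec.Properties using (lookup-map)
open import Data.Product using (_,_)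
open import Data.Sum using (inj₁; inj₂)
open import Relation.Binary.PropositionalEquality
  using (_≡_; refl; sym; trans; cong; cong₂; subst; subst₂)

private variable
  k m l n : ℕ

lift-fusion : {σ : Fin m → Fin l} {ρ : Fin k → Fin m} {τ : Fin k → Fin l} →
              (∀ i → σ (ρ i) ≡ τ i) → ∀ i → lift σ (lift ρ i) ≡ lift τ i
lift-fusion e zero    = refl
lift-fusion e (suc i) = cong suc (e i)

rename-fusion : {σ : Fin m → Fin l} {ρ : Fin k → Fin m} {τ : Fin k → Fin l} →
                (∀ i → σ (ρ i) ≡ τ i) → ∀ φ → rename σ (rename ρ φ) ≡ rename τ φ
rename-fusion e (x ∈' y) = cong₂ _∈'_ (e x) (e y)
rename-fusion e (x ≐ y)  = cong₂ _≐_ (e x) (e y)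
rename-fusion e ⊥'       = refl
rename-fusion e (φ ∧' ψ) = cong₂ _∧'_ (rename-fusion e φ) (rename-fusion e ψ)
rename-fusion e (φ ∨' ψ) = cong₂ _∨'_ (rename-fusion e φ) (rename-fusion e ψ)
rename-fusion e (φ ⇒ ψ)  = cong₂ _⇒_ (rename-fusion e φ) (rename-fusion e ψ)
rename-fusion e (∀' φ)   = cong ∀' (rename-fusion (lift-fusion e) φ)
rename-fusion e (∃' φ)   = cong ∃' (rename-fusion (lift-fusion e) φ)

lift-id : {ρ : Fin k → Fin k} → (∀ i → ρ i ≡ i) → ∀ i → lift ρ i ≡ i
lift-id e zero    = refl
lift-id e (suc i) = cong suc (e i)

rename-id : {ρ : Fin k → Fin k} → (∀ i → ρ i ≡ i) → ∀ φ → rename ρ φ ≡ φ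
rename-id e (x ∈' y) = cong₂ _∈'_ (e x) (e y)
rename-id e (x ≐ y)  = cong₂ _≐_ (e x) (e y)
rename-id e ⊥'       = refl
rename-id e (φ ∧' ψ) = cong₂ _∧'_ (rename-id e φ) (rename-id e ψ)
rename-id e (φ ∨' ψ) = cong₂ _∨'_ (rename-id e φ) (rename-id e ψ)
rename-id e (φ ⇒ ψ)  = cong₂ _⇒_ (rename-id e φ) (rename-id e ψ)
rename-id e (∀' φ)   = cong ∀' (rename-id (lift-id e) φ)
rename-id e (∃' φ)   = cong ∃' (rename-id (lift-id e) φ)

wk-rename : (ρ : Fin k → Fin m) (φ : Fm k) → rename (lift ρ) (wk φ) ≡ wk (rename ρ φ)
wk-rename ρ φ = trans (rename-fusion (λ _ → refl) φ) (sym (rename-fusion (λ _ → refl) φ))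

[]-rename : (ρ : Fin k → Fin m) (t : Fin k) (φ : Fm (suc k)) →
            rename ρ (φ [ t ]) ≡ rename (lift ρ) φ [ ρ t ]
[]-rename ρ t φ =
  trans (rename-fusion (λ _ → refl) φ) (sym (rename-fusion (λ { zero → refl ; (suc i) → refl }) φ))

lift-suc-[zero] : (φ : Fm (suc k)) → rename (lift suc) φ [ zero ] ≡ φ
lift-suc-[zero] φ =
  trans (rename-fusion (λ _ → refl) φ) (rename-id (λ { zero → refl ; (suc i) → refl }) φ)

map-commute : {A B C D : Set} {f : B → D} {g : A → B} {h : C → D} {j : A → C} →
              (∀ x → f (g x) ≡ h (j x)) → ∀ xs → map f (map g xs) ≡ map h (map j xs)
map-commute e xs = trans (sym (map-∘ xs)) (trans (map-cong e xs) (map-∘ xs))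

⊢-rename : (ρ : Fin k → Fin m) {Γ : List (Fm k)} {φ : Fm k} →
           Γ ⊢ φ → map (rename ρ) Γ ⊢ rename ρ φ
⊢-rename ρ (hyp p)    = hyp (∈-map⁺ _ p)
⊢-rename ρ (⊥E d)     = ⊥E (⊢-rename ρ d)
⊢-rename ρ (raa d)    = raa (⊢-rename ρ d)
⊢-rename ρ (⇒I d)     = ⇒I (⊢-rename ρ d)
⊢-rename ρ (⇒E d e)   = ⇒E (⊢-rename ρ d) (⊢-rename ρ e)
⊢-rename ρ (∧I d e)   = ∧I (⊢-rename ρ d) (⊢-rename ρ e)
⊢-rename ρ (∧E₁ d)    = ∧E₁ (⊢-rename ρ d)
⊢-rename ρ (∧E₂ d)    = ∧E₂ (⊢-rename ρ d)
⊢-rename ρ (∨I₁ d)    = ∨I₁ (⊢-rename ρ d)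
⊢-rename ρ (∨I₂ d)    = ∨I₂ (⊢-rename ρ d)
⊢-rename ρ (∨E d e f) = ∨E (⊢-rename ρ d) (⊢-rename ρ e) (⊢-rename ρ f)
⊢-rename ρ (∀I {Γ = Γ} {φ = φ} d) =
  ∀I (subst (_⊢ rename (lift ρ) φ) (map-commute (wk-rename ρ) Γ) (⊢-rename (lift ρ) d))
⊢-rename ρ (∀E {φ = φ} d t) =
  subst (_ ⊢_) (sym ([]-rename ρ t φ)) (∀E (⊢-rename ρ d) (ρ t))
⊢-rename ρ (∃I {φ = φ} t d) = ∃I (ρ t) (subst (_ ⊢_) ([]-rename ρ t φ) (⊢-rename ρ d))
⊢-rename ρ (∃E {Γ = Γ} {χ = χ} d e) =
  ∃E (⊢-rename ρ d)
     (subst₂ _⊢_ (cong (_ ∷_) (map-commute (wk-rename ρ) Γ)) (wk-rename ρ χ) (⊢-rename (lift ρ) e))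
⊢-rename ρ (≐refl t) = ≐refl (ρ t)
⊢-rename ρ (≐subst φ {s} {t} e d) =
  subst (_ ⊢_) (sym ([]-rename ρ t φ))
        (≐subst (rename (lift ρ) φ) (⊢-rename ρ e) (subst (_ ⊢_) ([]-rename ρ s φ) (⊢-rename ρ d)))

⊢-weaken : {Γ Δ : List (Fm k)} {φ : Fm k} → Γ ⊆ Δ → Γ ⊢ φ → Δ ⊢ φ
⊢-weaken s (hyp p)        = hyp (s p)
⊢-weaken s (⊥E d)         = ⊥E (⊢-weaken s d)
⊢-weaken s (raa d)        = raa (⊢-weaken (∷⁺ʳ _ s) d)
⊢-weaken s (⇒I d)         = ⇒I (⊢-weaken (∷⁺ʳ _ s) d)
⊢-weaken s (⇒E d e)       = ⇒E (⊢-weaken s d) (⊢-weaken s e)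
⊢-weaken s (∧I d e)       = ∧I (⊢-weaken s d) (⊢-weaken s e)
⊢-weaken s (∧E₁ d)        = ∧E₁ (⊢-weaken s d)
⊢-weaken s (∧E₂ d)        = ∧E₂ (⊢-weaken s d)
⊢-weaken s (∨I₁ d)        = ∨I₁ (⊢-weaken s d)
⊢-weaken s (∨I₂ d)        = ∨I₂ (⊢-weaken s d)
⊢-weaken s (∨E d e f)     = ∨E (⊢-weaken s d) (⊢-weaken (∷⁺ʳ _ s) e) (⊢-weaken (∷⁺ʳ _ s) f)
⊢-weaken s (∀I d)         = ∀I (⊢-weaken (map⁺-⊆ wk s) d)
⊢-weaken s (∀E d t)       = ∀E (⊢-weaken s d) t
⊢-weaken s (∃I t d)       = ∃I t (⊢-weaken s d)
⊢-weaken s (∃E d e)       = ∃E (⊢-weaken s d) (⊢-weaken (∷⁺ʳ _ (map⁺-⊆ wk s)) e)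
⊢-weaken s (≐refl t)      = ≐refl t
⊢-weaken s (≐subst φ e d) = ≐subst φ (⊢-weaken s e) (⊢-weaken s d)

⊢-cast : {Γ : List (Fm k)} {φ ψ : Fm k} → φ ≡ ψ → Γ ⊢ φ → Γ ⊢ ψ
⊢-cast = subst (_ ⊢_)

⊢-shift : {Γ : List (Fm k)} {φ : Fm k} {ψ : Fm (suc k)} → Γ ⊢ φ → (ψ ∷ map wk Γ) ⊢ wk φ
⊢-shift d = ⊢-weaken there (⊢-rename suc d)

∃-map : {Γ : List (Fm k)} {φ ψ : Fm (suc k)} → Γ ⊢ ∃' φ → (φ ∷ map wk Γ) ⊢ ψ → Γ ⊢ ∃' ψ
∃-map {ψ = ψ} d e = ∃E d (∃I zero (⊢-cast (sym (lift-suc-[zero] ψ)) e))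

∃∧-map : {Γ : List (Fm k)} {θ φ ψ : Fm (suc k)} →
         Γ ⊢ ∃' (θ ∧' φ) → (∀ {Δ} → Δ ⊢ φ → Δ ⊢ ψ) → Γ ⊢ ∃' (θ ∧' ψ)
∃∧-map d f = ∃-map d (∧I (∧E₁ (hyp (here refl))) (f (∧E₂ (hyp (here refl)))))

∀-map : {Γ : List (Fm k)} {φ ψ : Fm (suc k)} →
        Γ ⊢ ∀' φ → (∀ {Δ} → Δ ⊢ φ → Δ ⊢ ψ) → Γ ⊢ ∀' ψ
∀-map {φ = φ} d f = ∀I (f (⊢-cast (lift-suc-[zero] φ) (∀E (⊢-rename suc d) zero)))

-- Closure properties of Σₙ

Δ₀-rename : (ρ : Fin k → Fin m) {φ : Fm k} → Δ₀ φ → Δ₀ (rename ρ φ)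
Δ₀-rename ρ (d∈ x y)  = d∈ (ρ x) (ρ y)
Δ₀-rename ρ (d≐ x y)  = d≐ (ρ x) (ρ y)
Δ₀-rename ρ d⊥        = d⊥
Δ₀-rename ρ (d∧ a b)  = d∧ (Δ₀-rename ρ a) (Δ₀-rename ρ b)
Δ₀-rename ρ (d∨ a b)  = d∨ (Δ₀-rename ρ a) (Δ₀-rename ρ b)
Δ₀-rename ρ (d⇒ a b)  = d⇒ (Δ₀-rename ρ a) (Δ₀-rename ρ b)
Δ₀-rename ρ (d∀∈ y a) = d∀∈ (ρ y) (Δ₀-rename (lift ρ) a)
Δ₀-rename ρ (d∃∈ y a) = d∃∈ (ρ y) (Δ₀-rename (lift ρ) a)

IsΣ-rename : (ρ : Fin k → Fin m) {φ : Fm k} → IsΣ n φ → IsΣ n (rename ρ φ)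
IsΠ-rename : (ρ : Fin k → Fin m) {φ : Fm k} → IsΠ n φ → IsΠ n (rename ρ φ)
IsΣ-rename ρ (σ0 d) = σ0 (Δ₀-rename ρ d)
IsΣ-rename ρ (σπ p) = σπ (IsΠ-rename ρ p)
IsΣ-rename ρ (σ∃ s) = σ∃ (IsΣ-rename (lift ρ) s)
IsΠ-rename ρ (π0 d) = π0 (Δ₀-rename ρ d)
IsΠ-rename ρ (πσ s) = πσ (IsΣ-rename ρ s)
IsΠ-rename ρ (π∀ p) = π∀ (IsΠ-rename (lift ρ) p)

isSing-Δ₀ : (w x : Fin k) → Δ₀ (isSing w x)
isSing-Δ₀ w x = d∧ (d∈ _ _) (d∀∈ _ (d≐ _ _))

isUPair-Δ₀ : (w x y : Fin k) → Δ₀ (isUPair w x y)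
isUPair-Δ₀ w x y = d∧ (d∈ _ _) (d∧ (d∈ _ _) (d∀∈ _ (d∨ (d≐ _ _) (d≐ _ _))))

isPair-Δ₀ : (z x y : Fin k) → Δ₀ (isPair z x y)
isPair-Δ₀ z x y =
  d∧ (d∀∈ z (d∨ (isSing-Δ₀ _ _) (isUPair-Δ₀ _ _ _)))
     (d∧ (d∃∈ z (isSing-Δ₀ _ _)) (d∃∈ z (isUPair-Δ₀ _ _ _)))

conjΣ : {χ : Fm k} → Fm k → IsΣ n χ → Fm k
conjΠ : {χ : Fm k} → Fm k → IsΠ n χ → Fm k
conjΣ {χ = χ} θ (σ0 _) = θ ∧' χ
conjΣ θ (σπ p)         = conjΠ θ p
conjΣ θ (σ∃ s)         = ∃' (conjΣ (wk θ) s)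
conjΠ {χ = χ} θ (π0 _) = θ ∧' χ
conjΠ θ (πσ s)         = conjΣ θ s
conjΠ θ (π∀ p)         = ∀' (conjΠ (wk θ) p)

IsΣ-conjΣ : {χ θ : Fm k} → Δ₀ θ → (s : IsΣ n χ) → IsΣ n (conjΣ θ s)
IsΠ-conjΠ : {χ θ : Fm k} → Δ₀ θ → (p : IsΠ n χ) → IsΠ n (conjΠ θ p)
IsΣ-conjΣ dθ (σ0 d) = σ0 (d∧ dθ d)
IsΣ-conjΣ dθ (σπ p) = σπ (IsΠ-conjΠ dθ p)
IsΣ-conjΣ dθ (σ∃ s) = σ∃ (IsΣ-conjΣ (Δ₀-rename suc dθ) s)
IsΠ-conjΠ dθ (π0 d) = π0 (d∧ dθ d)
IsΠ-conjΠ dθ (πσ s) = πσ (IsΣ-conjΣ dθ s)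
IsΠ-conjΠ dθ (π∀ p) = π∀ (IsΠ-conjΠ (Δ₀-rename suc dθ) p)

-- The target context is nonempty so that θ can be extracted from ∀x (θ ∧ χ) by instantiation.
conjΣ⇒∧ : {χ : Fm k} (θ : Fm k) (s : IsΣ n χ) (ρ : Fin k → Fin (suc m)) {Γ : List (Fm (suc m))} →
          Γ ⊢ rename ρ (conjΣ θ s) → Γ ⊢ rename ρ θ ∧' rename ρ χ
conjΠ⇒∧ : {χ : Fm k} (θ : Fm k) (p : IsΠ n χ) (ρ : Fin k → Fin (suc m)) {Γ : List (Fm (suc m))} →
          Γ ⊢ rename ρ (conjΠ θ p) → Γ ⊢ rename ρ θ ∧' rename ρ χ
conjΣ⇒∧ θ (σ0 _) ρ h = h
conjΣ⇒∧ θ (σπ p) ρ h = conjΠ⇒∧ θ p ρ h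
conjΣ⇒∧ θ (σ∃ s) ρ h =
  ∧I (∃E h (⊢-cast (wk-rename ρ θ) (∧E₁ (conjΣ⇒∧ (wk θ) s (lift ρ) (hyp (here refl))))))
     (∃-map h (∧E₂ (conjΣ⇒∧ (wk θ) s (lift ρ) (hyp (here refl)))))
conjΠ⇒∧ θ (π0 _) ρ h = h
conjΠ⇒∧ θ (πσ s) ρ h = conjΣ⇒∧ θ s ρ h
conjΠ⇒∧ θ (π∀ p) ρ h =
  ∧I (⊢-cast (rename-fusion (λ _ → refl) θ)
       (∧E₁ (conjΠ⇒∧ (wk θ) p (λ i → sub0 zero (lift ρ i))
               (⊢-cast (rename-fusion (λ _ → refl) (conjΠ (wk θ) p)) (∀E h zero)))))
     (∀-map h (λ d → ∧E₂ (conjΠ⇒∧ (wk θ) p (lift ρ) d)))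

∧⇒conjΣ : {χ : Fm k} (θ : Fm k) (s : IsΣ n χ) (ρ : Fin k → Fin m) {Γ : List (Fm m)} →
          Γ ⊢ rename ρ θ ∧' rename ρ χ → Γ ⊢ rename ρ (conjΣ θ s)
∧⇒conjΠ : {χ : Fm k} (θ : Fm k) (p : IsΠ n χ) (ρ : Fin k → Fin m) {Γ : List (Fm m)} →
          Γ ⊢ rename ρ θ ∧' rename ρ χ → Γ ⊢ rename ρ (conjΠ θ p)
∧⇒conjΣ θ (σ0 _) ρ h = h
∧⇒conjΣ θ (σπ p) ρ h = ∧⇒conjΠ θ p ρ h
∧⇒conjΣ θ (σ∃ s) ρ h =
  ∃-map (∧E₂ h)
        (∧⇒conjΣ (wk θ) s (lift ρ) (∧I (⊢-cast (sym (wk-rename ρ θ)) (⊢-shift (∧E₁ h))) (hyp (here refl))))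
∧⇒conjΠ θ (π0 _) ρ h = h
∧⇒conjΠ θ (πσ s) ρ h = ∧⇒conjΣ θ s ρ h
∧⇒conjΠ θ (π∀ {φ = χ} p) ρ h =
  ∀I (∧⇒conjΠ (wk θ) p (lift ρ)
        (∧I (⊢-cast (sym (wk-rename ρ θ)) (⊢-rename suc (∧E₁ h)))
            (⊢-cast (lift-suc-[zero] (rename (lift ρ) χ)) (∀E (⊢-rename suc (∧E₂ h)) zero))))

bexΣ : {χ : Fm (suc k)} → Fin k → IsΣ n χ → Fm k
bexΣ w s = ∃' (conjΣ (v0 ∈' suc w) s)

IsΣ-bexΣ : {χ : Fm (suc k)} (w : Fin k) (s : IsΣ n χ) → IsΣ n (bexΣ w s)
IsΣ-bexΣ w (σ0 d)        = σ0 (d∃∈ w d)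
IsΣ-bexΣ {n = suc n} w s = σ∃ (IsΣ-conjΣ (d∈ _ _) s)

bexΣ-elim : {χ : Fm (suc k)} (w : Fin k) (s : IsΣ n χ) (ρ : Fin k → Fin m) {Γ : List (Fm m)} →
            Γ ⊢ rename ρ (bexΣ w s) → Γ ⊢ ∃' ((v0 ∈' suc (ρ w)) ∧' rename (lift ρ) χ)
bexΣ-elim w s ρ h = ∃-map h (conjΣ⇒∧ _ s (lift ρ) (hyp (here refl)))

bexΣ-intro : {χ : Fm (suc k)} (w : Fin k) (s : IsΣ n χ) (ρ : Fin k → Fin m) {Γ : List (Fm m)} →
             Γ ⊢ ∃' ((v0 ∈' suc (ρ w)) ∧' rename (lift ρ) χ) → Γ ⊢ rename ρ (bexΣ w s)
bexΣ-intro w s ρ h = ∃-map h (∧⇒conjΣ _ s (lift ρ) (hyp (here refl)))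

-- Formulas in which a fixed formula φ applied to a vector of variables is an atom, so that
-- renaming and substitution act on that vector and compute definitionally.
data Sch (k : ℕ) : Set where
  inst       : ∀ {j} → Fm j → Vec (Fin k) j → Sch k
  mem eq     : Fin k → Fin k → Sch k
  and or imp : Sch k → Sch k → Sch k
  all ex     : Sch (suc k) → Sch k

⟦_⟧ : Sch k → Fm k
⟦ inst φ vs ⟧ = rename (lookup vs) φ
⟦ mem x y ⟧   = x ∈' y
⟦ eq x y ⟧    = x ≐ y
⟦ and A B ⟧   = ⟦ A ⟧ ∧' ⟦ B ⟧
⟦ or A B ⟧    = ⟦ A ⟧ ∨' ⟦ B ⟧
⟦ imp A B ⟧   = ⟦ A ⟧ ⇒ ⟦ B ⟧
⟦ all A ⟧     = ∀' ⟦ A ⟧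
⟦ ex A ⟧      = ∃' ⟦ A ⟧

iff : Sch k → Sch k → Sch k
iff A B = and (imp A B) (imp B A)

renameˢ : (Fin k → Fin m) → Sch k → Sch m
renameˢ ρ (inst φ vs) = inst φ (vmap ρ vs)
renameˢ ρ (mem x y)   = mem (ρ x) (ρ y)
renameˢ ρ (eq x y)    = eq (ρ x) (ρ y)
renameˢ ρ (and A B)   = and (renameˢ ρ A) (renameˢ ρ B)
renameˢ ρ (or A B)    = or (renameˢ ρ A) (renameˢ ρ B)
renameˢ ρ (imp A B)   = imp (renameˢ ρ A) (renameˢ ρ B)
renameˢ ρ (all A)     = all (renameˢ (lift ρ) A)
renameˢ ρ (ex A)      = ex (renameˢ (lift ρ) A)

⟦⟧-renameˢ : (ρ : Fin k → Fin m) (A : Sch k) → ⟦ renameˢ ρ A ⟧ ≡ rename ρ ⟦ A ⟧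
⟦⟧-renameˢ ρ (inst φ vs) = sym (rename-fusion (λ i → sym (lookup-map i ρ vs)) φ)
⟦⟧-renameˢ ρ (mem x y)   = refl
⟦⟧-renameˢ ρ (eq x y)    = refl
⟦⟧-renameˢ ρ (and A B)   = cong₂ _∧'_ (⟦⟧-renameˢ ρ A) (⟦⟧-renameˢ ρ B)
⟦⟧-renameˢ ρ (or A B)    = cong₂ _∨'_ (⟦⟧-renameˢ ρ A) (⟦⟧-renameˢ ρ B)
⟦⟧-renameˢ ρ (imp A B)   = cong₂ _⇒_ (⟦⟧-renameˢ ρ A) (⟦⟧-renameˢ ρ B)
⟦⟧-renameˢ ρ (all A)     = cong ∀' (⟦⟧-renameˢ (lift ρ) A)
⟦⟧-renameˢ ρ (ex A)      = cong ∃' (⟦⟧-renameˢ (lift ρ) A)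

infix 3 _⊢ˢ_
record _⊢ˢ_ (Γ : List (Sch k)) (A : Sch k) : Set where
  constructor ⌜_⌝
  field ⌞_⌟ : map ⟦_⟧ Γ ⊢ ⟦ A ⟧
open _⊢ˢ_

private variable
  Γ : List (Sch k)

module _ {Γ : List (Sch k)} where

  private
    map-⟦⟧-shift : map ⟦_⟧ (map (renameˢ suc) Γ) ≡ map wk (map ⟦_⟧ Γ)
    map-⟦⟧-shift = map-commute (⟦⟧-renameˢ suc) Γ

  hypˢ : ∀ {A} → A ∈ Γ → Γ ⊢ˢ A
  hypˢ p = ⌜ hyp (∈-map⁺ ⟦_⟧ p) ⌝

  ⇒Iˢ : ∀ {A B} → (A ∷ Γ) ⊢ˢ B → Γ ⊢ˢ imp A B
  ⇒Iˢ d = ⌜ ⇒I ⌞ d ⌟ ⌝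

  ⇒Eˢ : ∀ {A B} → Γ ⊢ˢ imp A B → Γ ⊢ˢ A → Γ ⊢ˢ B
  ⇒Eˢ d e = ⌜ ⇒E ⌞ d ⌟ ⌞ e ⌟ ⌝

  ∧Iˢ : ∀ {A B} → Γ ⊢ˢ A → Γ ⊢ˢ B → Γ ⊢ˢ and A B
  ∧Iˢ d e = ⌜ ∧I ⌞ d ⌟ ⌞ e ⌟ ⌝

  ∧E₁ˢ : ∀ {A B} → Γ ⊢ˢ and A B → Γ ⊢ˢ A
  ∧E₁ˢ d = ⌜ ∧E₁ ⌞ d ⌟ ⌝

  ∧E₂ˢ : ∀ {A B} → Γ ⊢ˢ and A B → Γ ⊢ˢ B
  ∧E₂ˢ d = ⌜ ∧E₂ ⌞ d ⌟ ⌝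

  ∨I₁ˢ : ∀ {A B} → Γ ⊢ˢ A → Γ ⊢ˢ or A B
  ∨I₁ˢ d = ⌜ ∨I₁ ⌞ d ⌟ ⌝

  ∨I₂ˢ : ∀ {A B} → Γ ⊢ˢ B → Γ ⊢ˢ or A B
  ∨I₂ˢ d = ⌜ ∨I₂ ⌞ d ⌟ ⌝

  ∨Eˢ : ∀ {A B C} → Γ ⊢ˢ or A B → (A ∷ Γ) ⊢ˢ C → (B ∷ Γ) ⊢ˢ C → Γ ⊢ˢ C
  ∨Eˢ d e f = ⌜ ∨E ⌞ d ⌟ ⌞ e ⌟ ⌞ f ⌟ ⌝

  ∀Iˢ : ∀ {A} → map (renameˢ suc) Γ ⊢ˢ A → Γ ⊢ˢ all A
  ∀Iˢ {A} d = ⌜ ∀I (subst (_⊢ ⟦ A ⟧) map-⟦⟧-shift ⌞ d ⌟) ⌝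

  ∀Eˢ : ∀ {A} → Γ ⊢ˢ all A → (t : Fin k) → Γ ⊢ˢ renameˢ (sub0 t) A
  ∀Eˢ {A} d t = ⌜ ⊢-cast (sym (⟦⟧-renameˢ (sub0 t) A)) (∀E ⌞ d ⌟ t) ⌝

  ∃Iˢ : ∀ {A} (t : Fin k) → Γ ⊢ˢ renameˢ (sub0 t) A → Γ ⊢ˢ ex A
  ∃Iˢ {A} t d = ⌜ ∃I t (⊢-cast (⟦⟧-renameˢ (sub0 t) A) ⌞ d ⌟) ⌝

  ∃Eˢ : ∀ {A C} → Γ ⊢ˢ ex A → (A ∷ map (renameˢ suc) Γ) ⊢ˢ renameˢ suc C → Γ ⊢ˢ C
  ∃Eˢ {A} {C} d e =
    ⌜ ∃E ⌞ d ⌟ (subst₂ _⊢_ (cong (⟦ A ⟧ ∷_) map-⟦⟧-shift) (⟦⟧-renameˢ suc C) ⌞ e ⌟) ⌝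

  reflˢ : (t : Fin k) → Γ ⊢ˢ eq t t
  reflˢ t = ⌜ ≐refl t ⌝

  substˢ : (A : Sch (suc k)) {s t : Fin k} →
           Γ ⊢ˢ eq s t → Γ ⊢ˢ renameˢ (sub0 s) A → Γ ⊢ˢ renameˢ (sub0 t) A
  substˢ A {s} {t} e d =
    ⌜ ⊢-cast (sym (⟦⟧-renameˢ (sub0 t) A)) (≐subst ⟦ A ⟧ ⌞ e ⌟ (⊢-cast (⟦⟧-renameˢ (sub0 s) A) ⌞ d ⌟)) ⌝

  shiftˢ : ∀ {A} → Γ ⊢ˢ A → map (renameˢ suc) Γ ⊢ˢ renameˢ suc A
  shiftˢ {A} d =
    ⌜ subst₂ _⊢_ (sym map-⟦⟧-shift) (sym (⟦⟧-renameˢ suc A)) (⊢-rename suc ⌞ d ⌟) ⌝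

  weakenˢ : ∀ {A B} → Γ ⊢ˢ A → (B ∷ Γ) ⊢ˢ A
  weakenˢ d = ⌜ ⊢-weaken there ⌞ d ⌟ ⌝

↑ : {A : Sch k} {B : Sch (suc k)} →
    Γ ⊢ˢ A → (B ∷ map (renameˢ suc) Γ) ⊢ˢ renameˢ suc A
↑ d = weakenˢ (shiftˢ d)

h₀ : {A : Sch k} → (A ∷ Γ) ⊢ˢ A
h₀ = hypˢ (here refl)

h₁ : {A B : Sch k} → (B ∷ A ∷ Γ) ⊢ˢ A
h₁ = hypˢ (there (here refl))

h₂ : {A B C : Sch k} → (C ∷ B ∷ A ∷ Γ) ⊢ˢ A
h₂ = hypˢ (there (there (here refl)))

symˢ : {s t : Fin k} → Γ ⊢ˢ eq s t → Γ ⊢ˢ eq t s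
symˢ {s = s} e = substˢ (eq v0 (suc s)) e (reflˢ s)

transˢ : {r s t : Fin k} → Γ ⊢ˢ eq r s → Γ ⊢ˢ eq s t → Γ ⊢ˢ eq r t
transˢ {r = r} e f = substˢ (eq (suc r) v0) f e

-- Kuratowski pairs

-- ⟦_⟧ maps these to isSing, isUPair, isPair, Pairing and Product definitionally.
isSingˢ : Fin k → Fin k → Sch k
isSingˢ w x = and (mem x w) (all (imp (mem v0 (suc w)) (eq v0 (suc x))))

isUPairˢ : Fin k → Fin k → Fin k → Sch k
isUPairˢ w x y =
  and (mem x w) (and (mem y w) (all (imp (mem v0 (suc w)) (or (eq v0 (suc x)) (eq v0 (suc y))))))

isPairˢ : Fin k → Fin k → Fin k → Sch k
isPairˢ z x y =
  and (all (imp (mem v0 (suc z)) (or (isSingˢ v0 (suc x)) (isUPairˢ v0 (suc x) (suc y)))))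
      (and (ex (and (mem v0 (suc z)) (isSingˢ v0 (suc x))))
           (ex (and (mem v0 (suc z)) (isUPairˢ v0 (suc x) (suc y)))))

IsPairing : Fin k → Fin k → Fin k → Sch k
IsPairing c a b = all (iff (mem v0 (suc c)) (or (eq v0 (suc a)) (eq v0 (suc b))))

IsProduct : Fin k → Fin k → Fin k → Sch k
IsProduct c a b =
  all (iff (mem v0 (suc c))
           (ex (and (mem v0 (suc (suc a))) (ex (and (mem v0 (suc (suc (suc b)))) (isPairˢ v2 v1 v0))))))

PairingAx : Sch k
PairingAx = all (all (ex (IsPairing v0 v2 v1)))

ProductAx : Sch k
ProductAx = all (all (ex (IsProduct v0 v2 v1)))

pairing-set : Γ ⊢ˢ PairingAx → (a b : Fin k) → Γ ⊢ˢ ex (IsPairing v0 (suc a) (suc b))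
pairing-set d a b = ∀Eˢ (∀Eˢ d a) b

product-set : Γ ⊢ˢ ProductAx → (a b : Fin k) → Γ ⊢ˢ ex (IsProduct v0 (suc a) (suc b))
product-set d a b = ∀Eˢ (∀Eˢ d a) b

∈-pairingˡ : ∀ {c a b} → Γ ⊢ˢ IsPairing c a b → Γ ⊢ˢ mem a c
∈-pairingˡ {a = a} d = ⇒Eˢ (∧E₂ˢ (∀Eˢ d a)) (∨I₁ˢ (reflˢ a))

∈-pairingʳ : ∀ {c a b} → Γ ⊢ˢ IsPairing c a b → Γ ⊢ˢ mem b c
∈-pairingʳ {b = b} d = ⇒Eˢ (∧E₂ˢ (∀Eˢ d b)) (∨I₂ˢ (reflˢ b))

∈-pairing⁻ : ∀ {c a b w} → Γ ⊢ˢ IsPairing c a b → Γ ⊢ˢ mem w c → Γ ⊢ˢ or (eq w a) (eq w b)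
∈-pairing⁻ {w = w} d e = ⇒Eˢ (∧E₁ˢ (∀Eˢ d w)) e

∈-product : ∀ {c a b z x y} → Γ ⊢ˢ IsProduct c a b → Γ ⊢ˢ mem x a → Γ ⊢ˢ mem y b →
            Γ ⊢ˢ isPairˢ z x y → Γ ⊢ˢ mem z c
∈-product {z = z} {x} {y} d x∈a y∈b P = ⇒Eˢ (∧E₂ˢ (∀Eˢ d z)) (∃Iˢ x (∧Iˢ x∈a (∃Iˢ y (∧Iˢ y∈b P))))

isSing-pairing : ∀ {s x} → Γ ⊢ˢ IsPairing s x x → Γ ⊢ˢ isSingˢ s x
isSing-pairing d =
  ∧Iˢ (∈-pairingˡ d) (∀Iˢ (⇒Iˢ (∨Eˢ (∈-pairing⁻ (↑ d) h₀) h₀ h₀)))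

isUPair-pairing : ∀ {t x v} → Γ ⊢ˢ IsPairing t x v → Γ ⊢ˢ isUPairˢ t x v
isUPair-pairing d = ∧Iˢ (∈-pairingˡ d) (∧Iˢ (∈-pairingʳ d) (∀Iˢ (⇒Iˢ (∈-pairing⁻ (↑ d) h₀))))

isPair-pairing : ∀ {k} {Γ : List (Sch k)} {s t z x v : Fin k} →
                 Γ ⊢ˢ IsPairing s x x → Γ ⊢ˢ IsPairing t x v → Γ ⊢ˢ IsPairing z s t →
                 Γ ⊢ˢ isPairˢ z x v
isPair-pairing {k} {x = x} {v = v} s-spec t-spec z-spec =
  ∧Iˢ (∀Iˢ (⇒Iˢ (∨Eˢ (∈-pairing⁻ (↑ z-spec) h₀)
                      (substˢ Sing∨UPair (symˢ h₀) (∨I₁ˢ (isSing-pairing (weakenˢ (↑ s-spec)))))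
                      (substˢ Sing∨UPair (symˢ h₀) (∨I₂ˢ (isUPair-pairing (weakenˢ (↑ t-spec))))))))
      (∧Iˢ (∃Iˢ _ (∧Iˢ (∈-pairingˡ z-spec) (isSing-pairing s-spec)))
           (∃Iˢ _ (∧Iˢ (∈-pairingʳ z-spec) (isUPair-pairing t-spec))))
  where
  Sing∨UPair : Sch (suc (suc k))
  Sing∨UPair = or (isSingˢ v0 (suc (suc x))) (isUPairˢ v0 (suc (suc x)) (suc (suc v)))

isPair-exists : Γ ⊢ˢ PairingAx → (x v : Fin k) → Γ ⊢ˢ ex (isPairˢ v0 (suc x) (suc v))
isPair-exists pairing x v =
  ∃Eˢ (pairing-set pairing x x)
  (∃Eˢ (pairing-set (↑ pairing) (suc x) (suc v))
  (∃Eˢ (pairing-set (↑ (↑ pairing)) v1 v0)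
  (∃Iˢ v0 (isPair-pairing (↑ (↑ h₀)) (↑ h₀) h₀))))

isPair-fst-∈ : ∀ {z a b w} → Γ ⊢ˢ isPairˢ z a b → Γ ⊢ˢ mem w z → Γ ⊢ˢ mem a w
isPair-fst-∈ {w = w} P w∈z = ∨Eˢ (⇒Eˢ (∀Eˢ (∧E₁ˢ P) w) w∈z) (∧E₁ˢ h₀) (∧E₁ˢ h₀)

isPair-injectiveˡ : ∀ {z a b c d} → Γ ⊢ˢ isPairˢ z a b → Γ ⊢ˢ isPairˢ z c d → Γ ⊢ˢ eq a c
isPair-injectiveˡ {c = c} P Q =
  ∃Eˢ (∧E₁ˢ (∧E₂ˢ P))
      (symˢ (⇒Eˢ (∀Eˢ (∧E₂ˢ (∧E₂ˢ h₀)) (suc c)) (isPair-fst-∈ (↑ Q) (∧E₁ˢ h₀))))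

isPair-snd-either : ∀ {z a b c d} → Γ ⊢ˢ isPairˢ z a b → Γ ⊢ˢ isPairˢ z c d →
                    Γ ⊢ˢ or (eq b c) (eq b d)
isPair-snd-either {b = b} P Q =
  ∃Eˢ (∧E₂ˢ (∧E₂ˢ P))
      (∨Eˢ (⇒Eˢ (∀Eˢ (∧E₁ˢ (↑ Q)) v0) (∧E₁ˢ h₀))
           (∨I₁ˢ (⇒Eˢ (∀Eˢ (∧E₂ˢ h₀) (suc b)) (∧E₁ˢ (∧E₂ˢ (∧E₂ˢ h₁)))))
           (⇒Eˢ (∀Eˢ (∧E₂ˢ (∧E₂ˢ h₀)) (suc b)) (∧E₁ˢ (∧E₂ˢ (∧E₂ˢ h₁)))))

isPair-injectiveʳ : ∀ {z a b c d} → Γ ⊢ˢ isPairˢ z a b → Γ ⊢ˢ isPairˢ z c d → Γ ⊢ˢ eq b d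
isPair-injectiveʳ P Q =
  ∨Eˢ (isPair-snd-either P Q)
      (∨Eˢ (isPair-snd-either (weakenˢ Q) (weakenˢ P))
           (transˢ h₁ (transˢ (symˢ (isPair-injectiveˡ (weakenˢ (weakenˢ P)) (weakenˢ (weakenˢ Q))))
                              (symˢ h₀)))
           (symˢ h₀))
      h₀

-- Strong collection

Reflects : Sch (suc (suc k)) → Fin k → Fin k → Sch k
Reflects P p q = all (imp (mem v0 (suc p)) (iff (ex P) (ex (and (mem v0 (suc (suc q))) P))))

Collₛˢ : Fm 3 → Sch k
Collₛˢ φ = all (all (ex (Reflects (inst φ (v0 ∷ v1 ∷ v4 ∷ [])) v1 v0)))

Collₛ⁻ˢ : Fm 2 → Sch k
Collₛ⁻ˢ ψ = all (ex (Reflects (inst ψ (v0 ∷ v1 ∷ [])) v1 v0))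

⟦Collₛˢ⟧ : (φ : Fm 3) → ⟦ Collₛˢ {0} φ ⟧ ≡ wk0 (Collₛ φ)
⟦Collₛˢ⟧ φ =
  cong (λ X → ∀' (∀' (∃' (∀∈ v1 ((∃' X) ⇔ ∃∈ v1 X)))))
       (sym (rename-fusion (λ { zero → refl ; (suc zero) → refl ; (suc (suc zero)) → refl }) φ))

⟦Collₛ⁻ˢ⟧ : (ψ : Fm 2) → ⟦ Collₛ⁻ˢ {0} ψ ⟧ ≡ wk0 (Collₛ⁻ ψ)
⟦Collₛ⁻ˢ⟧ ψ =
  cong (λ X → ∀' (∃' (∀∈ v1 ((∃' X) ⇔ ∃∈ v1 X))))
       (sym (rename-fusion (λ { zero → refl ; (suc zero) → refl }) ψ))

Collₛ⇒Collₛ⁻ : (ψ : Fm 2) → Γ ⊢ˢ Collₛˢ (rename inject₁ ψ) → Γ ⊢ˢ Collₛ⁻ˢ ψ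
Collₛ⇒Collₛ⁻ ψ d =
  ∀Iˢ ⌜ ⊢-cast (cong (λ X → ∃' (∀∈ v1 ((∃' X) ⇔ ∃∈ v1 X)))
                     (rename-fusion (λ { zero → refl ; (suc zero) → refl }) ψ))
               ⌞ ∀Eˢ (∀Eˢ (shiftˢ d) v0) v0 ⌟ ⌝

module Encoding {n} (φ : Fm 3) (σφ : IsΣ n φ) where

  Φ : Fin k → Fin k → Fin k → Sch k
  Φ y x v = inst φ (y ∷ x ∷ v ∷ [])

  private
    -- The matrix z = ⟨b, c⟩ ∧ φ(b, y, c) of ψ lives in the context (c, b, a, y, z), innermost
    -- first; φ's de Bruijn variables (y, x, v) are placed at (y, b, c).
    φ-place : Fin 3 → Fin 5
    φ-place = lookup (v3 ∷ v1 ∷ v0 ∷ [])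

    φ-Σ : IsΣ n (rename φ-place φ)
    φ-Σ = IsΣ-rename φ-place σφ

    matrix-Σ : IsΣ n (conjΣ (isPair v4 v1 v0) φ-Σ)
    matrix-Σ = IsΣ-conjΣ (isPair-Δ₀ v4 v1 v0) φ-Σ

    ∃c∈a-Σ : IsΣ n (bexΣ v1 matrix-Σ)
    ∃c∈a-Σ = IsΣ-bexΣ v1 matrix-Σ

    ∃b∈a-Σ : IsΣ n (bexΣ v0 ∃c∈a-Σ)
    ∃b∈a-Σ = IsΣ-bexΣ v0 ∃c∈a-Σ

  ψ : Fm 2
  ψ = bexΣ v1 ∃b∈a-Σ

  IsΣ-ψ : IsΣ n ψ
  IsΣ-ψ = IsΣ-bexΣ v1 ∃b∈a-Σ

  Ψ : Fin k → Fin k → Sch k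
  Ψ y z = inst ψ (y ∷ z ∷ [])

  private
    φ-in-matrix : (ρ : Fin 2 → Fin k) →
                  rename (lift (lift (lift ρ))) (rename φ-place φ) ≡ ⟦ Φ (suc (suc (suc (ρ zero)))) v1 v0 ⟧
    φ-in-matrix ρ = rename-fusion (λ { zero → refl ; (suc zero) → refl ; (suc (suc zero)) → refl }) φ

    Ψ-unfolded : Fin k → Fin k → Sch k
    Ψ-unfolded y z =
      ex (and (mem v0 (suc z)) (ex (and (mem v0 v1) (ex (and (mem v0 v2)
        (and (isPairˢ (suc (suc (suc z))) v1 v0) (Φ (suc (suc (suc y))) v1 v0)))))))

    Ψ-unfold : ∀ {k} {Γ : List (Sch k)} {y z : Fin k} → Γ ⊢ˢ Ψ y z → Γ ⊢ˢ Ψ-unfolded y z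
    Ψ-unfold {k} {y = y} {z} d =
      ⌜ ∃∧-map (bexΣ-elim v1 ∃b∈a-Σ ρ ⌞ d ⌟) (λ e →
        ∃∧-map (bexΣ-elim v0 ∃c∈a-Σ (lift ρ) e) (λ e →
        ∃∧-map (bexΣ-elim v1 matrix-Σ (lift (lift ρ)) e) (λ e →
        ∧I (∧E₁ (conjΣ⇒∧ (isPair v4 v1 v0) φ-Σ (lift (lift (lift ρ))) e))
           (⊢-cast (φ-in-matrix ρ)
                   (∧E₂ (conjΣ⇒∧ (isPair v4 v1 v0) φ-Σ (lift (lift (lift ρ))) e)))))) ⌝
      where
      ρ : Fin 2 → Fin k
      ρ = lookup (y ∷ z ∷ [])

    Ψ-fold : ∀ {k} {Γ : List (Sch k)} {y z : Fin k} → Γ ⊢ˢ Ψ-unfolded y z → Γ ⊢ˢ Ψ y z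
    Ψ-fold {k} {y = y} {z} d =
      ⌜ bexΣ-intro v1 ∃b∈a-Σ ρ (∃∧-map ⌞ d ⌟ (λ e →
        bexΣ-intro v0 ∃c∈a-Σ (lift ρ) (∃∧-map e (λ e →
        bexΣ-intro v1 matrix-Σ (lift (lift ρ)) (∃∧-map e (λ e →
        ∧⇒conjΣ (isPair v4 v1 v0) φ-Σ (lift (lift (lift ρ)))
          (∧I (∧E₁ e)
              (⊢-cast (sym (φ-in-matrix ρ))
                      (∧E₂ e))))))))) ⌝
      where
      ρ : Fin 2 → Fin k
      ρ = lookup (y ∷ z ∷ [])

  Ψ-intro : ∀ {x y z v} → Γ ⊢ˢ isPairˢ z x v → Γ ⊢ˢ Φ y x v → Γ ⊢ˢ Ψ y z
  Ψ-intro {x = x} {v = v} P φyxv =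
    Ψ-fold (∃Eˢ (∧E₂ˢ (∧E₂ˢ P))
      (∃Iˢ v0 (∧Iˢ (∧E₁ˢ h₀)
        (∃Iˢ (suc x) (∧Iˢ (∧E₁ˢ (∧E₂ˢ h₀))
          (∃Iˢ (suc v) (∧Iˢ (∧E₁ˢ (∧E₂ˢ (∧E₂ˢ h₀))) (∧Iˢ (↑ P) (↑ φyxv)))))))))

  Φ-transport : ∀ {z b c x v y} → Γ ⊢ˢ isPairˢ z b c → Γ ⊢ˢ isPairˢ z x v → Γ ⊢ˢ Φ y b c → Γ ⊢ˢ Φ y x v
  Φ-transport {c = c} {x} {y = y} P Q d =
    substˢ (inst φ (suc y ∷ suc x ∷ v0 ∷ [])) (isPair-injectiveʳ P Q)
      (substˢ (inst φ (suc y ∷ v0 ∷ suc c ∷ [])) (isPair-injectiveˡ P Q) d)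

  Ψ-elim : ∀ {x y z v} → Γ ⊢ˢ Ψ y z → Γ ⊢ˢ isPairˢ z x v → Γ ⊢ˢ Φ y x v
  Ψ-elim Ψyz P =
    ∃Eˢ (Ψ-unfold Ψyz) (∃Eˢ (∧E₂ˢ h₀) (∃Eˢ (∧E₂ˢ h₀)
      (Φ-transport (∧E₁ˢ (∧E₂ˢ h₀)) (↑ (↑ (↑ P))) (∧E₂ˢ (∧E₂ˢ h₀)))))

  collect-witness : ∀ {s v c p q x} →
    Γ ⊢ˢ PairingAx → Γ ⊢ˢ IsPairing s v v → Γ ⊢ˢ IsProduct c p s → Γ ⊢ˢ Reflects (Ψ v0 v1) c q →
    Γ ⊢ˢ mem x p → Γ ⊢ˢ ex (Φ v0 (suc x) (suc v)) → Γ ⊢ˢ ex (and (mem v0 (suc q)) (Φ v0 (suc x) (suc v)))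
  collect-witness {v = v} {x = x} pairing s-spec c-spec reflects x∈p ∃Φ =
    ∃Eˢ ∃Φ                                                   -- y with φ(x, y, v)
    (∃Eˢ (isPair-exists (↑ pairing) (suc x) (suc v))         -- z = ⟨x, v⟩, an element of c
    (∃Eˢ (⇒Eˢ (∧E₁ˢ (⇒Eˢ (∀Eˢ (↑ (↑ reflects)) v0)           -- y′ ∈ q with ψ(z, y′)
                         (∈-product (↑ (↑ c-spec)) (↑ (↑ x∈p)) (∈-pairingˡ (↑ (↑ s-spec))) h₀)))
              (∃Iˢ v1 (Ψ-intro h₀ (↑ h₀))))
    (∃Iˢ v0 (∧Iˢ (∧E₁ˢ h₀) (Ψ-elim (∧E₂ˢ h₀) (↑ h₀))))))

  reflects-Φ : ∀ {k} {Γ : List (Sch k)} {s v c p q : Fin k} →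
    Γ ⊢ˢ PairingAx → Γ ⊢ˢ IsPairing s v v → Γ ⊢ˢ IsProduct c p s → Γ ⊢ˢ Reflects (Ψ v0 v1) c q →
    Γ ⊢ˢ Reflects (Φ v0 v1 (suc (suc v))) p q
  reflects-Φ {k} {Γ} pairing s-spec c-spec reflects =
    ∀Iˢ (⇒Iˢ (∧Iˢ (⇒Iˢ (collect-witness (lift² pairing) (lift² s-spec) (lift² c-spec) (lift² reflects)
                                         h₁ h₀))
                  (⇒Iˢ (∃Eˢ h₀ (∃Iˢ v0 (∧E₂ˢ h₀))))))
    where
    lift² : ∀ {A B C} → Γ ⊢ˢ A → (B ∷ C ∷ map (renameˢ suc) Γ) ⊢ˢ renameˢ suc A
    lift² d = weakenˢ (weakenˢ (shiftˢ d))

  collection : Γ ⊢ˢ PairingAx → Γ ⊢ˢ ProductAx → Γ ⊢ˢ Collₛ⁻ˢ ψ → Γ ⊢ˢ Collₛˢ φ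
  collection pairing product collects =
    ∀Iˢ (∀Iˢ                                                 -- v, p
    (∃Eˢ (pairing-set (shiftˢ (shiftˢ pairing)) v1 v1)       -- s = {v}
    (∃Eˢ (product-set (↑ (shiftˢ (shiftˢ product))) v1 v0)   -- c = p × s
    (∃Eˢ (∀Eˢ (↑ (↑ (shiftˢ (shiftˢ collects)))) v0)         -- q, by Coll_s⁻(ψ) on c
    (∃Iˢ v0 (reflects-Φ (↑ (↑ (↑ (shiftˢ (shiftˢ pairing))))) (↑ (↑ h₀)) (↑ h₀) h₀))))))

Collₛ⁻Σ-from-CollₛΣ : ∀ σ → Collₛ⁻Σ n σ → (DB₀ ∪ CollₛΣ n) ⊩ σ
Collₛ⁻Σ-from-CollₛΣ _ (coll⁻ ψ σψ) =
  0 , Collₛ (rename inject₁ ψ) ∷ [] , inj₂ (coll _ (IsΣ-rename inject₁ σψ)) ∷ [] ,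
  subst₂ _⊢_ (cong (_∷ []) (⟦Collₛˢ⟧ (rename inject₁ ψ))) (⟦Collₛ⁻ˢ⟧ ψ) ⌞ Collₛ⇒Collₛ⁻ ψ h₀ ⌟

CollₛΣ-from-Collₛ⁻Σ : ∀ σ → CollₛΣ n σ → (DB₀ ∪ Collₛ⁻Σ n) ⊩ σ
CollₛΣ-from-Collₛ⁻Σ _ (coll φ σφ) =
  0 , Collₛ⁻ ψ ∷ Pairing ∷ Product ∷ [] , inj₂ (coll⁻ ψ IsΣ-ψ) ∷ inj₁ pair ∷ inj₁ prod ∷ [] ,
  subst₂ _⊢_ (cong₂ _∷_ (⟦Collₛ⁻ˢ⟧ ψ) refl) (⟦Collₛˢ⟧ φ) ⌞ collection h₁ h₂ h₀ ⌟
  where open Encoding φ σφ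

mainTheorem3 : (n : ℕ) → EquivOver DB₀ (Collₛ⁻Σ n) (CollₛΣ n)
mainTheorem3 n = CollₛΣ-from-Collₛ⁻Σ , Collₛ⁻Σ-from-CollₛΣ
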